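{- Let $A$ be a set with $|A| = \aleph_0$, let $C$ be a constantive clone on $A$ with quasigroup operations, and let $m \in \mathbb{N}$. Then the following are equivalent: (1) $|(\operatorname{Pol}\operatorname{Inv} C)^{[1]}| \le \aleph_0$. (2) $C^{[1]}$ has a finite base of equality. (3) $C^{[m]}$ has a finite base of equality. (4) $|C| \le \aleph_0$ and there exists $d \in \mathbb{N}$ such that for all $n \in \mathbb{N}$: $C^{[n]} = (\operatorname{Pol}\operatorname{Inv}^{[d^n+1]} C)^{[n]}$. (5) $|C| \le \aleph_0$ and for all $n \in \mathbb{N}$ there exists $k \in \mathbb{N}$ with $C^{[n]} = (\operatorname{Pol}\operatorname{Inv}^{[k]} C)^{[n]}$. (6) $|C| \le \aleph_0$ and $C = \operatorname{Pol}\operatorname{Inv} C$.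
   Context: A clone on $A$ is a set of finitary operations on $A$ containing all projections and closed under composition. A clone is constantive if it contains all unary constant operations on $A$. For a clone $C$, $\operatorname{Inv} C$ is the set of all finitary relations on $A$ preserved by every function in $C$, and $\operatorname{Inv}^{[k]} C$ is the set of $k$-ary relations in $\operatorname{Inv} C$; for a set $R$ of relations, $\operatorname{Pol} R$ is the set of all finitary operations on $A$ preserving every relation in $R$. $F^{[n]}$ denotes the set of $n$-ary operations in $F$. $C$ is a clone with quasigroup operations if there are binary operations $\cdot, \backslash, / \in C$ such that $(A; \cdot, \backslash, /)$ is a quasigroup. For $F \subseteq A^B$, a subset $D \subseteq B$ is a base of equality for $F$ if for all $f,g\in F$ with $f|_D = g|_D$ we have $f = g$ (here $C^{[n]} \subseteq A^{A^n}$). -}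

module Defs where

open import Level using (0ℓ) renaming (suc to lsuc)
open import Data.Nat using (ℕ; zero; suc)
open import Data.Fin using (Fin)
open import Data.Vec using (Vec; []; _∷_; lookup; tabulate; map)
open import Data.List using (List)
open import Data.List.Membership.Propositional using (_∈_)
open import Data.Product using (Σ; ∃; _×_)
open import Relation.Nullary using (¬_)
open import Relation.Binary.PropositionalEquality using (_≡_)
open import Algebra.Structures using (IsQuasigroup)

Op : Set → ℕ → Set
Op A n = Vec A n → A

OpSet : Set → Set₁
OpSet A = (n : ℕ) → Op A n → Set

_≈op_ : {A : Set} {n : ℕ} → Op A n → Op A n → Set
f ≈op g = ∀ x → f x ≡ g x

Rel : Set → ℕ → Set₁
Rel A k = Vec A k → Set

bin : {A : Set} → Op A 2 → A → A → A
bin f x y = f (x ∷ y ∷ [])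

record IsClone {A : Set} (C : OpSet A) : Set₁ where
  field
    ext     : ∀ {n} {f g : Op A n} → f ≈op g → C n f → C n g
    nonull  : ∀ (f : Op A 0) → ¬ C 0 f
    proj    : ∀ n (i : Fin n) → C n (λ x → lookup x i)
    comp    : ∀ {n k} {f : Op A k} {gs : Fin k → Op A n} →
              C k f → (∀ i → C n (gs i)) →
              C n (λ x → f (tabulate (λ i → gs i x)))

Constantive : {A : Set} → OpSet A → Set
Constantive {A} C = ∀ (a : A) → C 1 (λ _ → a)

HasQuasigroupOps : {A : Set} → OpSet A → Set
HasQuasigroupOps {A} C =
  Σ (Op A 2) λ m → Σ (Op A 2) λ l → Σ (Op A 2) λ r →
    C 2 m × C 2 l × C 2 r × IsQuasigroup (_≡_ {A = A}) (bin m) (bin l) (bin r)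

Preserves : {A : Set} {n k : ℕ} → Op A n → Rel A k → Set
Preserves {A} {n} {k} f R =
  ∀ (rows : Vec (Vec A k) n) → (∀ j → R (lookup rows j)) →
    R (tabulate (λ i → f (map (λ r → lookup r i) rows)))

Inv : {A : Set} → OpSet A → (k : ℕ) → Rel A k → Set
Inv C k R = ∀ n (f : Op _ n) → C n f → Preserves f R

PolInvK : {A : Set} → OpSet A → ℕ → (n : ℕ) → Op A n → Set₁
PolInvK C k n f = ∀ (R : Rel _ k) → Inv C k R → Preserves f R

PolInv : {A : Set} → OpSet A → (n : ℕ) → Op A n → Set₁
PolInv C n f = ∀ k → PolInvK C k n f

-- |S| ≤ ℵ₀ for a set of operations (all arities): covered by an
-- ℕ-indexed family in each arity
CountableOps : {A : Set} {ℓ : Level.Level} → ((n : ℕ) → Op A n → Set ℓ) → Set ℓ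
CountableOps {A} S =
  Σ ((n : ℕ) → ℕ → Op A n) λ e → ∀ n f → S n f → ∃ λ i → e n i ≈op f

CountableArity : {A : Set} {ℓ : Level.Level} → ((n : ℕ) → Op A n → Set ℓ) → ℕ → Set ℓ
CountableArity {A} S n =
  Σ (ℕ → Op A n) λ e → ∀ f → S n f → ∃ λ i → e i ≈op f

HasFiniteBase : {A : Set} → OpSet A → ℕ → Set
HasFiniteBase {A} C n =
  Σ (List (Vec A n)) λ D → ∀ (f g : Op A n) → C n f → C n g →
    (∀ x → x ∈ D → f x ≡ g x) → f ≈op g

SameArity : {A : Set} {ℓ ℓ' : Level.Level} →
  ((n : ℕ) → Op A n → Set ℓ) → ((n : ℕ) → Op A n → Set ℓ') → ℕ → Set _
SameArity {A} S T n = ∀ (f : Op A n) → (S n f → T n f) × (T n f → S n f)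

-- The n-ary members of Pol Inv^[k] C are exactly the operations that agree with some member of
-- C on every k points ("k-interpolable"), so Pol Inv C is the local closure of C.  A finite
-- base D of C^[1] yields, using constants and projections, a base D^n of C^[n]; C^[n] then
-- embeds into A^(|D|^n), hence is countable, and an operation that is (|D|^n + 1)-interpolable
-- agrees on D^n ∪ {x} with members of C that all coincide, so it lies in C.  Conversely, if C^[1]
-- has no finite base, any two of its members that agree on a finite set D but not everywhere
-- let the quasigroup operations perturb a given unary member off a prescribed operation without
-- changing it on D; diagonalising against an enumeration of (Pol Inv C)^[1] produces a locally
-- C, hence Pol Inv C, unary operation outside the enumeration.

module Submission where

open import Defs
open import Level using (0ℓ) renaming (suc to lsuc)
open import Data.Nat using (ℕ; zero; suc; _≤_; _^_; _+_; _*_; _⊔_; _≤′_; ≤′-refl; ≤′-step)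
open import Data.Nat.Properties using (+-comm; +-suc; +-identityʳ; *-identityʳ; ≤-trans; m≤m⊔n; m≤n⊔m; ≤⇒≤′)
open import Data.Fin using (Fin)
open import Data.Vec using (Vec; []; _∷_; head; lookup; tabulate; map; replicate)
open import Data.Vec.Properties using (lookup∘tabulate; tabulate∘lookup; tabulate-cong; lookup-map)
open import Data.List as List using (List; length; cartesianProductWith)
open import Data.List.Properties using (length-++; length-map; ∷-injective)
open import Data.List.Relation.Unary.Any using (here; there; index)
open import Data.List.Relation.Unary.Any.Properties using (lookup-index)
open import Data.List.Membership.Propositional using (_∈_)
open import Data.List.Membership.Propositional.Properties using (∈-map⁺; ∈-cartesianProductWith⁺)
open import Data.Product using (Σ; ∃; _×_; _,_; proj₁; proj₂)
open import Data.Empty using (⊥-elim)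
open import Function using (_∘_)
open import Function.Definitions using (StrictlySurjective)
open import Function.Bundles using (_⤖_; _⇔_; mk⇔; module Bijection)
open import Relation.Nullary using (¬_; Dec; yes; no)
open import Relation.Nullary.Decidable using (decidable-stable)
open import Relation.Binary.PropositionalEquality
  using (_≡_; _≢_; refl; sym; trans; cong; cong₂; subst)
open import Algebra.Bundles using (Quasigroup)
import Algebra.Properties.Quasigroup as QuasigroupProperties
open import Axiom.ExcludedMiddle using (ExcludedMiddle)

private
  variable
    X Y Z : Set

-- unpair walks the anti-diagonals (0,0), (1,0), (0,1), (2,0), (1,1), (0,2), …
unpair-step : ℕ × ℕ → ℕ × ℕ
unpair-step (zero , b) = suc b , 0
unpair-step (suc a , b) = a , suc b

unpair : ℕ → ℕ × ℕ
unpair zero = 0 , 0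
unpair (suc i) = unpair-step (unpair i)

unpair-walk : ∀ a b → (∃ λ i → unpair i ≡ (a + b , 0)) → ∃ λ j → unpair j ≡ (a , b)
unpair-walk a zero (i , eq) = i , trans eq (cong (_, 0) (+-identityʳ a))
unpair-walk a (suc b) (i , eq) with unpair-walk (suc a) b (i , trans eq (cong (_, 0) (+-suc a b)))
... | j , eq′ = suc j , cong unpair-step eq′

unpair-axis : ∀ c → ∃ λ i → unpair i ≡ (c , 0)
unpair-axis zero = 0 , refl
unpair-axis (suc c) with unpair-walk 0 c (unpair-axis c)
... | j , eq = suc j , cong unpair-step eq

unpair-surjective : StrictlySurjective _≡_ unpair
unpair-surjective (a , b) = unpair-walk a b (unpair-axis (a + b))

decode : (ℕ → X) → ℕ → ℕ → List X
decode s zero _ = List.[]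
decode s (suc l) i = s (proj₁ (unpair i)) List.∷ decode s l (proj₂ (unpair i))

decode-surjective : (s : ℕ → X) → StrictlySurjective _≡_ s →
  ∀ xs → ∃ λ i → decode s (length xs) i ≡ xs
decode-surjective s s-onto List.[] = 0 , refl
decode-surjective s s-onto (x List.∷ xs)
  with s-onto x | decode-surjective s s-onto xs
... | a , sa≡x | b , dec≡xs with unpair-surjective (a , b)
... | i , unpair≡ = i , cong₂ List._∷_
  (trans (cong (s ∘ proj₁) unpair≡) sa≡x)
  (trans (cong (decode s (length xs) ∘ proj₂) unpair≡) dec≡xs)

map-≡⇒≡-on : ∀ {f g : X → Y} {xs x} → List.map f xs ≡ List.map g xs → x ∈ xs → f x ≡ g x
map-≡⇒≡-on {xs = _ List.∷ _} eq (here refl) = proj₁ (∷-injective eq)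
map-≡⇒≡-on {xs = _ List.∷ _} eq (there x∈xs) = map-≡⇒≡-on (proj₂ (∷-injective eq)) x∈xs

length-cartesianProductWith : ∀ (f : X → Y → Z) xs ys →
  length (cartesianProductWith f xs ys) ≡ length xs * length ys
length-cartesianProductWith f List.[] ys = refl
length-cartesianProductWith f (x List.∷ xs) ys =
  trans (length-++ (List.map (f x) ys))
        (cong₂ _+_ (length-map (f x) ys) (length-cartesianProductWith f xs ys))

upper-bound : ∀ {k} (g : Fin k → ℕ) → ∃ λ J → ∀ i → g i ≤ J
upper-bound {zero} g = 0 , λ ()
upper-bound {suc k} g with upper-bound (g ∘ Fin.suc)
... | J , g≤J = g Fin.zero ⊔ J , λ
  { Fin.zero → m≤m⊔n _ J
  ; (Fin.suc i) → ≤-trans (g≤J i) (m≤n⊔m (g Fin.zero) J) }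

≡-tabulate : ∀ {n} {v : Vec X n} {f : Fin n → X} → (∀ i → lookup v i ≡ f i) → v ≡ tabulate f
≡-tabulate {v = v} eq = trans (sym (tabulate∘lookup v)) (tabulate-cong eq)

module CloneTheory {A : Set} {C : OpSet A} (isClone : IsClone C) where
  open IsClone isClone

  AgreeOn : ∀ {n} → List (Vec A n) → Op A n → Op A n → Set
  AgreeOn D f g = ∀ x → x ∈ D → f x ≡ g x

  IsBase : (n : ℕ) → List (Vec A n) → Set
  IsBase n D = ∀ (f g : Op A n) → C n f → C n g → AgreeOn D f g → f ≈op g

  nullary-base : IsBase 0 ([] List.∷ List.[])
  nullary-base f g _ _ agree [] = agree [] (here refl)

  head∈C : C 1 head
  head∈C = ext (λ { (a ∷ []) → refl }) (proj 1 Fin.zero)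

  bin∈C : ∀ {n op} {f g : Op A n} → C 2 op → C n f → C n g → C n (λ x → bin op (f x) (g x))
  bin∈C {n} {f = f} {g} op∈C f∈C g∈C = comp {gs = args} op∈C args∈C
    where
    args : Fin 2 → Op A n
    args Fin.zero = f
    args (Fin.suc _) = g

    args∈C : ∀ i → C n (args i)
    args∈C Fin.zero = f∈C
    args∈C (Fin.suc _) = g∈C

  C⊆PolInvK : ∀ {k n} {f : Op A n} → C n f → PolInvK C k n f
  C⊆PolInvK {n = n} {f} f∈C R R-inv = R-inv n f f∈C

  Interpolable : ℕ → (n : ℕ) → Op A n → Set
  Interpolable k n f = ∀ (pt : Fin k → Vec A n) → ∃ λ g → C n g × (∀ i → g (pt i) ≡ f (pt i))

  module _ {n k} (pt : Fin k → Vec A n) where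
    Values : Rel A k
    Values t = ∃ λ g → C n g × (∀ i → lookup t i ≡ g (pt i))

    values-inv : Inv C k Values
    values-inv m h h∈C rows rows∈ =
      (λ x → h (tabulate (λ j → proj₁ (rows∈ j) x))) , comp h∈C (λ j → proj₁ (proj₂ (rows∈ j))) ,
      λ i → trans (lookup∘tabulate _ i) (cong h (≡-tabulate λ j →
        trans (lookup-map j (λ r → lookup r i) rows) (proj₂ (proj₂ (rows∈ j)) i)))

    -- row j lists the j-th coordinates of the points, so column i is the point pt i
    coordinates : Vec (Vec A k) n
    coordinates = tabulate (λ j → tabulate (λ i → lookup (pt i) j))

    lookup-coordinates : ∀ i j → lookup (lookup coordinates j) i ≡ lookup (pt i) j
    lookup-coordinates i j = trans (cong (λ r → lookup r i) (lookup∘tabulate _ j)) (lookup∘tabulate _ i)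

    coordinates∈Values : ∀ j → Values (lookup coordinates j)
    coordinates∈Values j = (λ x → lookup x j) , proj n j , λ i → lookup-coordinates i j

    column-coordinates : ∀ i → map (λ r → lookup r i) coordinates ≡ pt i
    column-coordinates i = trans
      (≡-tabulate λ j → trans (lookup-map j (λ r → lookup r i) coordinates) (lookup-coordinates i j))
      (tabulate∘lookup (pt i))

  polInvK⇒interpolable : ∀ {k n} {f : Op A n} → PolInvK C k n f → Interpolable k n f
  polInvK⇒interpolable {f = f} f∈ pt
    with f∈ (Values pt) (values-inv pt) (coordinates pt) (coordinates∈Values pt)
  ... | g , g∈C , values≡ = g , g∈C , λ i →
    trans (sym (values≡ i)) (trans (lookup∘tabulate _ i) (cong f (column-coordinates pt i)))

  interpolable⇒polInvK : ∀ {k n} {f : Op A n} → Interpolable k n f → PolInvK C k n f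
  interpolable⇒polInvK {n = n} f∼ R R-inv rows rows∈R
    with f∼ (λ i → map (λ r → lookup r i) rows)
  ... | g , g∈C , g≈f = subst R (tabulate-cong g≈f) (R-inv n g g∈C rows rows∈R)

  interpolate-on : ∀ {n} {f : Op A n} (P : List (Vec A n)) → PolInvK C (length P) n f →
    ∃ λ g → C n g × AgreeOn P g f
  interpolate-on {f = f} P f∈ with polInvK⇒interpolable {f = f} f∈ (List.lookup P)
  ... | g , g∈C , g≈f = g , g∈C , λ x x∈P →
    subst (λ y → g y ≡ f y) (sym (lookup-index x∈P)) (g≈f (index x∈P))

  -- interpolating f on P ∪ {x} for each x gives members of C that all agree, by the base property
  base⇒polInvK⊆C : ∀ {n} {P : List (Vec A n)} {f : Op A n} → IsBase n P → Vec A n →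
    PolInvK C (suc (length P)) n f → C n f
  base⇒polInvK⊆C {n} {P} {f} P-base x₀ f∈ with interpolate-on {f = f} (x₀ List.∷ P) f∈
  ... | g₀ , g₀∈C , g₀≈f = ext g₀≈f-everywhere g₀∈C
    where
    g₀≈f-everywhere : g₀ ≈op f
    g₀≈f-everywhere x with interpolate-on {f = f} (x List.∷ P) f∈
    ... | g , g∈C , g≈f = trans
      (P-base g₀ g g₀∈C g∈C (λ y y∈P → trans (g₀≈f y (there y∈P)) (sym (g≈f y (there y∈P)))) x)
      (g≈f x (here refl))

  diagonal-base : ∀ {n} {P : List (Vec A (suc n))} → IsBase (suc n) P →
    IsBase 1 (List.map (λ x → lookup x Fin.zero ∷ []) P)
  diagonal-base {n} {P} P-base f g f∈C g∈C agree (a ∷ []) =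
    P-base _ _ (comp f∈C (λ _ → proj (suc n) Fin.zero)) (comp g∈C (λ _ → proj (suc n) Fin.zero))
      (λ x x∈P → agree _ (∈-map⁺ _ x∈P))
      (replicate (suc n) a)

  module _ (constantive : Constantive C) where
    const∈C : ∀ n (a : A) → C (suc n) (λ _ → a)
    const∈C n a = comp (constantive a) (λ _ → proj (suc n) Fin.zero)

    fix-head : ∀ {n} {f : Op A (suc (suc n))} → C _ f → ∀ a → C (suc n) (λ ys → f (a ∷ ys))
    fix-head {n} {f} f∈C a =
      ext (λ ys → cong (λ t → f (a ∷ t)) (tabulate∘lookup ys)) (comp {gs = args} f∈C args∈C)
      where
      args : Fin (suc (suc n)) → Op A (suc n)
      args Fin.zero = λ _ → a
      args (Fin.suc i) = λ ys → lookup ys i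

      args∈C : ∀ i → C (suc n) (args i)
      args∈C Fin.zero = const∈C n a
      args∈C (Fin.suc i) = proj (suc n) i

    fix-tail : ∀ {n} {f : Op A (suc n)} → C _ f → ∀ ys → C 1 (λ z → f (head z ∷ ys))
    fix-tail {n} {f} f∈C ys =
      ext (λ z → cong (λ t → f (head z ∷ t)) (tabulate∘lookup ys)) (comp {gs = args} f∈C args∈C)
      where
      args : Fin (suc n) → Op A 1
      args Fin.zero = head
      args (Fin.suc i) = λ _ → lookup ys i

      args∈C : ∀ i → C 1 (args i)
      args∈C Fin.zero = head∈C
      args∈C (Fin.suc i) = constantive (lookup ys i)

    module _ {D₁ : List (Vec A 1)} (D₁-base : IsBase 1 D₁) where
      cons-heads : ∀ {n} → List (Vec A n) → List (Vec A (suc n))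
      cons-heads = cartesianProductWith (λ d ys → head d ∷ ys) D₁

      product-base : ∀ {n} {P : List (Vec A (suc n))} → IsBase (suc n) P →
        IsBase (suc (suc n)) (cons-heads P)
      product-base P-base f g f∈C g∈C agree (x ∷ ys) =
        D₁-base _ _ (fix-tail f∈C ys) (fix-tail g∈C ys)
          (λ d d∈D₁ → P-base _ _ (fix-head f∈C (head d)) (fix-head g∈C (head d))
            (λ y y∈P → agree _ (∈-cartesianProductWith⁺ _ d∈D₁ y∈P)) ys)
          (x ∷ [])

      power-base : ∀ n → List (Vec A n)
      power-base zero = [] List.∷ List.[]
      power-base (suc zero) = D₁
      power-base (suc (suc n)) = cons-heads (power-base (suc n))

      power-base-isBase : ∀ n → IsBase n (power-base n)
      power-base-isBase zero = nullary-base
      power-base-isBase (suc zero) = D₁-base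
      power-base-isBase (suc (suc n)) = product-base (power-base-isBase (suc n))

      length-power-base : ∀ n → length (power-base n) ≡ length D₁ ^ n
      length-power-base zero = refl
      length-power-base (suc zero) = sym (*-identityʳ _)
      length-power-base (suc (suc n)) =
        trans (length-cartesianProductWith _ D₁ (power-base (suc n)))
              (cong (length D₁ *_) (length-power-base (suc n)))

      polInvK⊆C : A → ∀ n {f : Op A n} → PolInvK C (length D₁ ^ n + 1) n f → C n f
      polInvK⊆C a n {f} f∈ = base⇒polInvK⊆C (power-base-isBase n) (replicate n a)
        (subst (λ k → PolInvK C k n f)
               (trans (+-comm _ 1) (cong suc (sym (length-power-base n)))) f∈)

  Separated : List (Vec A 1) → Set
  Separated D = ∃ λ u → ∃ λ v → C 1 u × C 1 v × AgreeOn D u v × ∃ λ a → u a ≢ v a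

  -- w = (f ∙ v) / u equals f where u = v, and differs from f where u ≠ v
  separated⇒perturbable : HasQuasigroupOps C → ∀ {D} → Separated D → ∀ {f} → C 1 f →
    ∃ λ w → C 1 w × AgreeOn D w f × ∃ λ a → w a ≢ f a
  separated⇒perturbable (_ , _ , _ , mul∈C , _ , rdiv∈C , isQuasigroup) {D}
    (u , v , u∈C , v∈C , u≈v , a , ua≢va) {f} f∈C = w , w∈C , w≈f , a , wa≢fa
    where
    quasigroup : Quasigroup 0ℓ 0ℓ
    quasigroup = record { isQuasigroup = isQuasigroup }
    open Quasigroup quasigroup using (_∙_; _//_; rightDividesˡ; rightDividesʳ)
    open QuasigroupProperties quasigroup using (cancelˡ)

    w : Op A 1
    w x = (f x ∙ v x) // u x

    w∈C : C 1 w
    w∈C = bin∈C rdiv∈C (bin∈C mul∈C f∈C v∈C) u∈C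

    w≈f : AgreeOn D w f
    w≈f x x∈D = trans (cong (λ t → (f x ∙ t) // u x) (sym (u≈v x x∈D))) (rightDividesʳ (u x) (f x))

    wa≢fa : w a ≢ f a
    wa≢fa wa≡fa = ua≢va (cancelˡ (f a) (u a) (v a)
      (trans (cong (_∙ u a) (sym wa≡fa)) (rightDividesˡ (u a) (f a ∙ v a))))

  Flexible : Set
  Flexible = ∀ {f} → C 1 f → ∀ D (g : Op A 1) →
    ∃ λ f′ → C 1 f′ × AgreeOn D f′ f × ∃ λ a → f′ a ≢ g a

  module _ {s : ℕ → A} (s-onto : StrictlySurjective _≡_ s) where
    module Diagonal (flexible : Flexible) (e : ℕ → Op A 1) where
      -- stage j + 1 avoids e j at a new point and adds the j-th point s j to the support
      stage : ℕ → Σ (Op A 1) (C 1) × List (Vec A 1)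
      stage zero = (head , head∈C) , List.[]
      stage (suc j) with flexible (proj₂ (proj₁ (stage j))) (proj₂ (stage j)) (e j)
      ... | f′ , f′∈C , _ , a , _ = (f′ , f′∈C) , (s j ∷ []) List.∷ a List.∷ proj₂ (stage j)

      F : ℕ → Op A 1
      F j = proj₁ (proj₁ (stage j))

      F∈C : ∀ j → C 1 (F j)
      F∈C j = proj₂ (proj₁ (stage j))

      support : ℕ → List (Vec A 1)
      support j = proj₂ (stage j)

      F-step : ∀ j → AgreeOn (support j) (F (suc j)) (F j)
      F-step j with flexible (F∈C j) (support j) (e j)
      ... | _ , _ , f′≈f , _ = f′≈f

      F-avoids : ∀ j → ∃ λ a → a ∈ support (suc j) × F (suc j) a ≢ e j a
      F-avoids j with flexible (F∈C j) (support j) (e j)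
      ... | _ , _ , _ , a , f′a≢ = a , there (here refl) , f′a≢

      F-stable : ∀ {j J x} → j ≤′ J → x ∈ support j → x ∈ support J × F J x ≡ F j x
      F-stable ≤′-refl x∈ = x∈ , refl
      F-stable (≤′-step j≤J) x∈ with F-stable j≤J x∈
      ... | x∈′ , eq = there (there x∈′) , trans (F-step _ _ x∈′) eq

      entry-stage : Vec A 1 → ℕ
      entry-stage (a ∷ []) = suc (proj₁ (s-onto a))

      ∈-entry-stage : ∀ x → x ∈ support (entry-stage x)
      ∈-entry-stage (a ∷ []) = here (cong (_∷ []) (sym (proj₂ (s-onto a))))

      limit : Op A 1
      limit x = F (entry-stage x) x

      limit-agrees : ∀ j {x} → x ∈ support j → limit x ≡ F j x
      limit-agrees j {x} x∈ = trans
        (sym (proj₂ (F-stable (≤⇒≤′ (m≤n⊔m j (entry-stage x))) (∈-entry-stage x))))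
        (proj₂ (F-stable (≤⇒≤′ (m≤m⊔n j (entry-stage x))) x∈))

      limit∈PolInv : PolInv C 1 limit
      limit∈PolInv k = interpolable⇒polInvK {f = limit} λ pt →
        let J , bound = upper-bound (entry-stage ∘ pt)
        in F J , F∈C J , λ i →
          sym (limit-agrees J (proj₁ (F-stable (≤⇒≤′ (bound i)) (∈-entry-stage (pt i)))))

      limit-new : ∀ i → ¬ e i ≈op limit
      limit-new i eᵢ≈limit with F-avoids i
      ... | a , a∈ , Fa≢ = Fa≢ (trans (sym (limit-agrees (suc i) a∈)) (sym (eᵢ≈limit a)))

    flexible⇒uncountable : Flexible → ¬ CountableArity (PolInv C) 1
    flexible⇒uncountable flexible (e , covers) =
      let open Diagonal flexible e
          i , eᵢ≈limit = covers limit limit∈PolInv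
      in limit-new i eᵢ≈limit

  module _ (em : ExcludedMiddle 0ℓ) where
    ¬base⇒separated : ¬ HasFiniteBase C 1 → ∀ D → Separated D
    ¬base⇒separated ¬base D = decidable-stable em λ ¬separated →
      ¬base (D , λ f g f∈C g∈C agree x → decidable-stable em λ fx≢gx →
        ¬separated (f , g , f∈C , g∈C , agree , x , fx≢gx))

    -- either f already differs from g somewhere, or its perturbation does
    avoid : HasQuasigroupOps C → ¬ HasFiniteBase C 1 → Flexible
    avoid quasigroup ¬base {f} f∈C D g
      with separated⇒perturbable quasigroup (¬base⇒separated ¬base D) f∈C
    ... | w , w∈C , w≈f , a , wa≢fa with em {f a ≡ g a}
    ... | yes fa≡ga = w , w∈C , w≈f , a , λ wa≡ga → wa≢fa (trans wa≡ga (sym fa≡ga))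
    ... | no fa≢ga = f , f∈C , (λ _ _ → refl) , a , fa≢ga

    module _ {s : ℕ → A} (s-onto : StrictlySurjective _≡_ s) where
      finiteBase⇒countable : ∀ {n} → HasFiniteBase C n → CountableArity C n
      finiteBase⇒countable {n} (P , P-base) = enum , enum-covers
        where
        Codes : ℕ → Op A n → Set
        Codes i g = C n g × List.map g P ≡ decode s (length P) i

        pick : ∀ {i} → Dec (∃ (Codes i)) → Op A n
        pick (yes (g , _)) = g
        pick (no _) = λ _ → s 0

        pick≈ : ∀ {i f} (d : Dec (∃ (Codes i))) → Codes i f → pick d ≈op f
        pick≈ {f = f} (yes (g , g∈C , g-codes)) (f∈C , f-codes) =
          P-base g f g∈C f∈C (λ x → map-≡⇒≡-on (trans g-codes (sym f-codes)))
        pick≈ (no ¬codes) f-codes = ⊥-elim (¬codes (_ , f-codes))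

        enum : ℕ → Op A n
        enum i = pick (em {∃ (Codes i)})

        enum-covers : ∀ f → C n f → ∃ λ i → enum i ≈op f
        enum-covers f f∈C with decode-surjective s s-onto (List.map f P)
        ... | i , decode≡ = i , pick≈ em
          (f∈C , sym (subst (λ l → decode s l i ≡ List.map f P) (length-map f P) decode≡))

      finiteBases⇒countable : (∀ n → HasFiniteBase C n) → CountableOps C
      finiteBases⇒countable bases =
        (λ n → proj₁ (finiteBase⇒countable (bases n))) , λ n → proj₂ (finiteBase⇒countable (bases n))

      polInvCountable⇒finiteBase : HasQuasigroupOps C →
        CountableArity (PolInv C) 1 → HasFiniteBase C 1
      polInvCountable⇒finiteBase quasigroup countable = decidable-stable em λ ¬base →
        flexible⇒uncountable s-onto (avoid quasigroup ¬base) countable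

theorem5p3 : ExcludedMiddle 0ℓ → ExcludedMiddle (lsuc 0ℓ) →
    (A : Set) → A ⤖ ℕ →
    (C : OpSet A) → IsClone C → Constantive C → HasQuasigroupOps C →
    (m : ℕ) → 1 ≤ m →
    let
      s1 = CountableArity (PolInv C) 1
      s2 = HasFiniteBase C 1
      s3 = HasFiniteBase C m
      s4 = CountableOps C × ∃ λ d → ∀ n → SameArity C (PolInvK C (d ^ n + 1)) n
      s5 = CountableOps C × ∀ n → ∃ λ k → SameArity C (PolInvK C k) n
      s6 = CountableOps C × ∀ n → SameArity C (PolInv C) n
    in (s1 ⇔ s2) × (s2 ⇔ s3) × (s3 ⇔ s4) × (s4 ⇔ s5) × (s5 ⇔ s6)
theorem5p3 em _ A bij C isClone constantive quasigroup (suc m) _ =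
  mk⇔ 1⇒2 2⇒1 , mk⇔ 2⇒3 3⇒2 , mk⇔ (2⇒4 ∘ 3⇒2) (2⇒3 ∘ 1⇒2 ∘ 4⇒1) ,
  mk⇔ 4⇒5 (2⇒4 ∘ 1⇒2 ∘ 5⇒1) , mk⇔ 5⇒6 (4⇒5 ∘ 2⇒4 ∘ 1⇒2 ∘ 6⇒1)
  where
  open CloneTheory isClone
  open Bijection bij using (to; to⁻; injective; strictlySurjective)

  to⁻-onto : StrictlySurjective _≡_ to⁻
  to⁻-onto a = to a , injective (proj₂ (strictlySurjective (to a)))

  Condition₄ Condition₅ Condition₆ : Set₁
  Condition₄ = CountableOps C × ∃ λ d → ∀ n → SameArity C (PolInvK C (d ^ n + 1)) n
  Condition₅ = CountableOps C × ∀ n → ∃ λ k → SameArity C (PolInvK C k) n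
  Condition₆ = CountableOps C × ∀ n → SameArity C (PolInv C) n

  1⇒2 : CountableArity (PolInv C) 1 → HasFiniteBase C 1
  1⇒2 = polInvCountable⇒finiteBase em to⁻-onto quasigroup

  2⇒3 : HasFiniteBase C 1 → HasFiniteBase C (suc m)
  2⇒3 (D₁ , D₁-base) = power-base constantive D₁-base (suc m) , power-base-isBase constantive D₁-base (suc m)

  3⇒2 : HasFiniteBase C (suc m) → HasFiniteBase C 1
  3⇒2 (P , P-base) = _ , diagonal-base P-base

  2⇒4 : HasFiniteBase C 1 → Condition₄
  2⇒4 (D₁ , D₁-base) =
    finiteBases⇒countable em to⁻-onto
      (λ n → power-base constantive D₁-base n , power-base-isBase constantive D₁-base n) ,
    length D₁ , λ n f → C⊆PolInvK , polInvK⊆C constantive D₁-base (to⁻ 0) n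

  4⇒5 : Condition₄ → Condition₅
  4⇒5 (countable , d , same) = countable , λ n → d ^ n + 1 , same n

  5⇒6 : Condition₅ → Condition₆
  5⇒6 (countable , same) = countable , λ n f →
    (λ f∈C k → C⊆PolInvK f∈C) , λ f∈ → proj₂ (proj₂ (same n) f) (f∈ (proj₁ (same n)))

  6⇒1 : Condition₆ → CountableArity (PolInv C) 1
  6⇒1 ((e , covers) , same) = e 1 , λ f f∈ → covers 1 f (proj₂ (same 1 f) f∈)

  5⇒1 : Condition₅ → CountableArity (PolInv C) 1
  5⇒1 = 6⇒1 ∘ 5⇒6

  4⇒1 : Condition₄ → CountableArity (PolInv C) 1
  4⇒1 = 5⇒1 ∘ 4⇒5

  2⇒1 : HasFiniteBase C 1 → CountableArity (PolInv C) 1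
  2⇒1 = 4⇒1 ∘ 2⇒4
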